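{- Let $M = (S, S_0, R, L)$ be a Kripke structure, let $(\alpha,\gamma)$ be an abstraction/concretization pair, and let $\alpha(M) = (\hat{S}, \hat{S}_0, R_{must}, R_{may}, \hat{L})$ be the abstract KMTS of $M$. Let $(\hat{s}_1,\hat{s}_2) \in R_{must}$. For $s_1\in\gamma(\hat{s}_1)$ put $R_m = \{(s_1,s_2)\in R \mid s_2\in\gamma(\hat{s}_2)\}$, and let $K_{min}$ be the set of all structures $M' = (S,S_0,R\setminus R_m,L)$ obtained this way for some $s_1\in\gamma(\hat{s}_1)$. Then for every $M'\in K_{min}$, $1\le d(M,M')\le |S|$.
   Context: Let $AP$ be a set of atomic propositions and $Lit = AP\cup\{\neg p \mid p \in AP\}$. A Kripke structure is $M = (S,S_0,R,L)$ with $S$ finite, $S_0\subseteq S$, $R \subseteq S\times S$ total (every state has a successor), and $L: S\to 2^{Lit}$ such that for every $s$ and $p\in AP$, exactly one of $p,\neg p$ is in $L(s)$. An abstraction/concretization pair consists of total functions $\alpha: S\to\hat{S}$, $\gamma:\hat{S}\to 2^S$ with $\alpha(s)=\hat{s} \iff s\in\gamma(\hat{s})$. The abstract KMTS $\alpha(M) = (\hat{S},\hat{S}_0,R_{must},R_{may},\hat{L})$ is given by: $\hat{s}\in\hat{S}_0$ iff some $s\in\gamma(\hat{s})$ is in $S_0$; $lit\in\hat{L}(\hat{s})$ only if $lit\in L(s)$ for all $s\in\gamma(\hat{s})$; $R_{must} = \{(\hat{s}_1,\hat{s}_2) \mid \forall s_1\in\gamma(\hat{s}_1)\,\exists s_2\in\gamma(\hat{s}_2):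 (s_1,s_2)\in R\}$; $R_{may} = \{(\hat{s}_1,\hat{s}_2) \mid \exists s_1\in\gamma(\hat{s}_1)\,\exists s_2\in\gamma(\hat{s}_2): (s_1,s_2)\in R\}$. For a function $f:X\to Y$ and $X_1\subseteq X$, $\pi(f\restriction_{X_1}) = \{(x,f(x))\mid x\in X_1\}$; $A\,\Delta\,B = (A\setminus B)\cup(B\setminus A)$. For $M=(S,S_0,R,L)$ and $M'=(S',S'_0,R',L')$ the distance is $d(M,M') = |S\,\Delta\,S'| + |R\,\Delta\,R'| + \tfrac12\,|\pi(L\restriction_{S\cap S'})\,\Delta\,\pi(L'\restriction_{S\cap S'})|$. -}

module Defs where

open import Data.Nat using (ℕ; _+_; _/_)
open import Data.Bool using (Bool; true; false; _∧_; _∨_; not; _xor_; if_then_else_)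
open import Data.Fin using (Fin)
import Data.Fin as Fin
open import Data.Vec using (Vec)
open import Data.Vec.Properties using (≡-dec)
import Data.Bool.Properties as BoolP
open import Data.List using (map; allFin)
open import Data.Nat.ListAction using (sum)
open import Data.Product using (Σ; _×_; ∃-syntax)
open import Relation.Binary.PropositionalEquality using (_≡_)
open import Relation.Nullary.Decidable using (⌊_⌋)

-- Structures whose state set S is a (finite) subset of the universe Fin N,
-- over the atomic propositions AP = Fin k.  A labelling L(s) ⊆ Lit satisfying
-- "exactly one of p, ¬p" is the same as a valuation AP → Bool, stored as Vec Bool k.
record Structure (N k : ℕ) : Set where
  field
    inS : Fin N → Bool
    inS₀ : Fin N → Bool
    R : Fin N → Fin N → Bool
    L : Fin N → Vec Bool k
open Structure public

record IsKripke {N k : ℕ} (M : Structure N k) : Set where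
  field
    S₀⊆S : ∀ s → inS₀ M s ≡ true → inS M s ≡ true
    R⊆S×S : ∀ s t → R M s t ≡ true → (inS M s ≡ true) × (inS M t ≡ true)
    total : ∀ s → inS M s ≡ true → ∃[ t ] (R M s t ≡ true)

count : {N : ℕ} → (Fin N → Bool) → ℕ
count {N} P = sum (map (λ x → if P x then 1 else 0) (allFin N))

count₂ : {N : ℕ} → (Fin N → Fin N → Bool) → ℕ
count₂ {N} P = sum (map (λ x → count (P x)) (allFin N))

_≟L_ : {k : ℕ} → Vec Bool k → Vec Bool k → Bool
u ≟L v = ⌊ ≡-dec BoolP._≟_ u v ⌋

-- |π(L↾S∩S') Δ π(L'↾S∩S')|: for s ∈ S ∩ S', the pairs (s,L s), (s,L' s)
-- are both in the symmetric difference iff L s ≠ L' s, contributing 2.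
labelΔ : {N k : ℕ} → Structure N k → Structure N k → ℕ
labelΔ {N} M M' = sum (map (λ s → if inS M s ∧ inS M' s ∧ not (L M s ≟L L M' s) then 2 else 0) (allFin N))

d : {N k : ℕ} → Structure N k → Structure N k → ℕ
d M M' = count (λ s → inS M s xor inS M' s)
       + count₂ (λ s t → R M s t xor R M' s t)
       + labelΔ M M' / 2

-- abstraction α : S → Ŝ with Ŝ = Fin m; γ(ŝ) = {s ∈ S | α s = ŝ}
inγ : {N k m : ℕ} → Structure N k → (Fin N → Fin m) → Fin m → Fin N → Bool
inγ M α ŝ s = inS M s ∧ ⌊ α s Fin.≟ ŝ ⌋

Rmust : {N k m : ℕ} → Structure N k → (Fin N → Fin m) → Fin m → Fin m → Set
Rmust M α ŝ₁ ŝ₂ = ∀ s₁ → inγ M α ŝ₁ s₁ ≡ true →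
  ∃[ s₂ ] ((inγ M α ŝ₂ s₂ ≡ true) × (R M s₁ s₂ ≡ true))

Rmay : {N k m : ℕ} → Structure N k → (Fin N → Fin m) → Fin m → Fin m → Set
Rmay M α ŝ₁ ŝ₂ = ∃[ s₁ ] ∃[ s₂ ] ((inγ M α ŝ₁ s₁ ≡ true) × (inγ M α ŝ₂ s₂ ≡ true) × (R M s₁ s₂ ≡ true))

removeRm : {N k m : ℕ} → Structure N k → (Fin N → Fin m) → Fin m → Fin N → Structure N k
removeRm M α ŝ₂ s₁ = record
  { inS = inS M
  ; inS₀ = inS₀ M
  ; R = λ s t → R M s t ∧ not (⌊ s Fin.≟ s₁ ⌋ ∧ inγ M α ŝ₂ t)
  ; L = L M }

InKmin : {N k m : ℕ} → Structure N k → (Fin N → Fin m) → Fin m → Fin m → Structure N k → Set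
InKmin M α ŝ₁ ŝ₂ M' = ∃[ s₁ ] ((inγ M α ŝ₁ s₁ ≡ true) × (M' ≡ removeRm M α ŝ₂ s₁))

module Submission where

open import Defs
open import Data.Nat using (ℕ; zero; suc; _+_; _/_; _≤_; z≤n)
open import Data.Nat.Properties using (≤-refl; ≤-trans; +-mono-≤; m≤m+n; m≤n+m; +-identityʳ; module ≤-Reasoning)
open import Data.Fin using (Fin; zero; suc; _≟_)
open import Data.Fin.Properties using (suc-injective)
open import Data.Bool using (Bool; true; false; _∧_; not; _xor_; if_then_else_)
open import Data.Bool.Properties using (xor-same; ∧-zeroʳ) renaming (_≟_ to _≟B_)
open import Data.List using (map; allFin; tabulate)
open import Data.List.Properties using (map-tabulate; tabulate-cong)
open import Data.Nat.ListAction using (sum)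
open import Data.Vec using (Vec)
open import Data.Vec.Properties using (≡-dec)
open import Data.Product using (_×_; _,_; proj₂)
open import Function using (_∘_; id)
open import Relation.Binary.PropositionalEquality
  using (_≡_; _≢_; refl; sym; trans; cong; cong₂; module ≡-Reasoning)
open import Relation.Nullary using (yes; no; contradiction)
open import Relation.Nullary.Decidable using (⌊_⌋; isYes≗does; dec-true)

-- Proof idea: deleting the R-edges from one state s₁ ∈ γ(ŝ₁) into γ(ŝ₂) changes
-- neither states nor labels, so d(M, M') is the number of deleted edges.  Since
-- (ŝ₁, ŝ₂) ∈ R_must, s₁ has at least one such edge, and their targets are
-- distinct states of S.

∑ : {N : ℕ} → (Fin N → ℕ) → ℕ
∑ f = sum (tabulate f)

sum-map-allFin : {N : ℕ} (f : Fin N → ℕ) → sum (map f (allFin N)) ≡ ∑ f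
sum-map-allFin f = cong sum (map-tabulate id f)

∑-cong : {N : ℕ} {f g : Fin N → ℕ} → (∀ x → f x ≡ g x) → ∑ f ≡ ∑ g
∑-cong f≗g = cong sum (tabulate-cong f≗g)

∑-mono : {N : ℕ} {f g : Fin N → ℕ} → (∀ x → f x ≤ g x) → ∑ f ≤ ∑ g
∑-mono {zero}  f≤g = z≤n
∑-mono {suc N} f≤g = +-mono-≤ (f≤g zero) (∑-mono (f≤g ∘ suc))

≤-∑ : {N : ℕ} (f : Fin N → ℕ) (x : Fin N) → f x ≤ ∑ f
≤-∑ f zero    = m≤m+n (f zero) _
≤-∑ f (suc x) = ≤-trans (≤-∑ (f ∘ suc) x) (m≤n+m _ (f zero))

∑-zero : {N : ℕ} {f : Fin N → ℕ} → (∀ x → f x ≡ 0) → ∑ f ≡ 0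
∑-zero {zero}  f≡0 = refl
∑-zero {suc N} f≡0 = cong₂ _+_ (f≡0 zero) (∑-zero (f≡0 ∘ suc))

∑-single : {N : ℕ} (f : Fin N → ℕ) (s : Fin N) → (∀ x → x ≢ s → f x ≡ 0) → ∑ f ≡ f s
∑-single f zero f≡0 =
  trans (cong (f zero +_) (∑-zero (λ x → f≡0 (suc x) λ ()))) (+-identityʳ (f zero))
∑-single f (suc s) f≡0 =
  cong₂ _+_ (f≡0 zero λ ()) (∑-single (f ∘ suc) s (λ x x≢s → f≡0 (suc x) (x≢s ∘ suc-injective)))

count≡∑ : {N : ℕ} (P : Fin N → Bool) → count P ≡ ∑ (λ x → if P x then 1 else 0)
count≡∑ P = sum-map-allFin (λ x → if P x then 1 else 0)

count₂≡∑ : {N : ℕ} (Q : Fin N → Fin N → Bool) → count₂ Q ≡ ∑ (count ∘ Q)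
count₂≡∑ Q = sum-map-allFin (count ∘ Q)

count-cong : {N : ℕ} {P Q : Fin N → Bool} → (∀ x → P x ≡ Q x) → count P ≡ count Q
count-cong {P = P} {Q} P≗Q = begin
  count P                         ≡⟨ count≡∑ P ⟩
  ∑ (λ x → if P x then 1 else 0)  ≡⟨ ∑-cong (λ x → cong (if_then 1 else 0) (P≗Q x)) ⟩
  ∑ (λ x → if Q x then 1 else 0)  ≡⟨ count≡∑ Q ⟨
  count Q                         ∎
  where open ≡-Reasoning

count-mono : {N : ℕ} {P Q : Fin N → Bool} → (∀ x → P x ≡ true → Q x ≡ true) → count P ≤ count Q
count-mono {P = P} {Q} P⊆Q = begin
  count P                         ≡⟨ count≡∑ P ⟩
  ∑ (λ x → if P x then 1 else 0)  ≤⟨ ∑-mono indicator-mono ⟩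
  ∑ (λ x → if Q x then 1 else 0)  ≡⟨ count≡∑ Q ⟨
  count Q                         ∎
  where
  open ≤-Reasoning
  indicator-mono : ∀ x → (if P x then 1 else 0) ≤ (if Q x then 1 else 0)
  indicator-mono x with P x | P⊆Q x
  ... | false | _   = z≤n
  ... | true  | Qx rewrite Qx refl = ≤-refl

count-pos : {N : ℕ} (P : Fin N → Bool) (x : Fin N) → P x ≡ true → 1 ≤ count P
count-pos P x Px = begin
  1                               ≡⟨ cong (if_then 1 else 0) Px ⟨
  (if P x then 1 else 0)          ≤⟨ ≤-∑ (λ y → if P y then 1 else 0) x ⟩
  ∑ (λ y → if P y then 1 else 0)  ≡⟨ count≡∑ P ⟨
  count P                         ∎
  where open ≤-Reasoning

count-false : {N : ℕ} {P : Fin N → Bool} → (∀ x → P x ≡ false) → count P ≡ 0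
count-false {P = P} P≡false =
  trans (count≡∑ P) (∑-zero (λ x → cong (if_then 1 else 0) (P≡false x)))

count₂-cong : {N : ℕ} {P Q : Fin N → Fin N → Bool} → (∀ s t → P s t ≡ Q s t) → count₂ P ≡ count₂ Q
count₂-cong {P = P} {Q} P≗Q =
  trans (count₂≡∑ P) (trans (∑-cong (λ s → count-cong (P≗Q s))) (sym (count₂≡∑ Q)))

count₂-row : {N : ℕ} (Q : Fin N → Fin N → Bool) (s : Fin N) →
  (∀ x → x ≢ s → ∀ t → Q x t ≡ false) → count₂ Q ≡ count (Q s)
count₂-row Q s Q≡false =
  trans (count₂≡∑ Q) (∑-single (count ∘ Q) s (λ x x≢s → count-false (Q≡false x x≢s)))

≟L-refl : {k : ℕ} (v : Vec Bool k) → (v ≟L v) ≡ true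
≟L-refl v = trans (isYes≗does v≟v) (dec-true v≟v refl)
  where v≟v = ≡-dec _≟B_ v v

d-withEdges : {N k : ℕ} (M : Structure N k) (R' : Fin N → Fin N → Bool) →
  d M (record M { R = R' }) ≡ count₂ (λ s t → R M s t xor R' s t)
d-withEdges {N} M R' = begin
  d M M'                                              ≡⟨ cong₂ (λ a b → a + Δ + b) no-state-Δ no-label-Δ ⟩
  Δ + 0                                               ≡⟨ +-identityʳ Δ ⟩
  Δ                                                   ∎
  where
  open ≡-Reasoning
  M' = record M { R = R' }
  Δ  = count₂ (λ s t → R M s t xor R' s t)
  no-state-Δ : count (λ s → inS M s xor inS M s) ≡ 0
  no-state-Δ = count-false (xor-same ∘ inS M)
  label-mismatch : Fin N → ℕ
  label-mismatch s = if inS M s ∧ inS M s ∧ not (L M s ≟L L M s) then 2 else 0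
  same-label : ∀ s → inS M s ∧ inS M s ∧ not (L M s ≟L L M s) ≡ false
  same-label s rewrite ≟L-refl (L M s) | ∧-zeroʳ (inS M s) = ∧-zeroʳ (inS M s)
  no-label-Δ : labelΔ M M' / 2 ≡ 0
  no-label-Δ = cong (_/ 2) (trans (sum-map-allFin label-mismatch)
    (∑-zero (λ s → cong (if_then 2 else 0) (same-label s))))

xor-∧-not : ∀ r b → r xor (r ∧ not b) ≡ r ∧ b
xor-∧-not false b = refl
xor-∧-not true false = refl
xor-∧-not true true = refl

d-removeRm : {N k m : ℕ} (M : Structure N k) (α : Fin N → Fin m) (ŝ₂ : Fin m) (s₁ : Fin N) →
  d M (removeRm M α ŝ₂ s₁) ≡ count (λ t → R M s₁ t ∧ inγ M α ŝ₂ t)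
d-removeRm M α ŝ₂ s₁ = begin
  -- removeRm only replaces R, so it is definitionally a record update of M.
  d M (removeRm M α ŝ₂ s₁)                         ≡⟨ d-withEdges M _ ⟩
  count₂ (λ s t → R M s t xor R M' s t)            ≡⟨ count₂-cong (λ s t → xor-∧-not (R M s t) _) ⟩
  count₂ removed                                   ≡⟨ count₂-row removed s₁ off-row ⟩
  count (removed s₁)                               ≡⟨ count-cong on-row ⟩
  count (λ t → R M s₁ t ∧ inγ M α ŝ₂ t)            ∎
  where
  open ≡-Reasoning
  M' = removeRm M α ŝ₂ s₁
  removed : Fin _ → Fin _ → Bool
  removed s t = R M s t ∧ (⌊ s ≟ s₁ ⌋ ∧ inγ M α ŝ₂ t)
  off-row : ∀ s → s ≢ s₁ → ∀ t → removed s t ≡ false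
  off-row s s≢s₁ t with s ≟ s₁
  ... | yes s≡s₁ = contradiction s≡s₁ s≢s₁
  ... | no _     = ∧-zeroʳ (R M s t)
  on-row : ∀ t → removed s₁ t ≡ R M s₁ t ∧ inγ M α ŝ₂ t
  on-row t with s₁ ≟ s₁
  ... | yes _    = refl
  ... | no s₁≢s₁ = contradiction refl s₁≢s₁

proposition5p12 : {N k m : ℕ} (M : Structure N k) → IsKripke M →
    (α : Fin N → Fin m) → (ŝ₁ ŝ₂ : Fin m) → Rmust M α ŝ₁ ŝ₂ →
    (M' : Structure N k) → InKmin M α ŝ₁ ŝ₂ M' →
    (1 ≤ d M M') × (d M M' ≤ count (inS M))
proposition5p12 M isKripke α ŝ₁ ŝ₂ must M' (s₁ , s₁∈γŝ₁ , refl)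
  rewrite d-removeRm M α ŝ₂ s₁ = at-least-one , at-most-|S|
  where
  open IsKripke isKripke
  at-least-one : 1 ≤ count (λ t → R M s₁ t ∧ inγ M α ŝ₂ t)
  at-least-one with must s₁ s₁∈γŝ₁
  ... | s₂ , s₂∈γŝ₂ , s₁Rs₂ = count-pos _ s₂ (cong₂ _∧_ s₁Rs₂ s₂∈γŝ₂)
  target-in-S : ∀ t → R M s₁ t ∧ inγ M α ŝ₂ t ≡ true → inS M t ≡ true
  target-in-S t with R M s₁ t in s₁Rt
  ... | true  = λ _ → proj₂ (R⊆S×S s₁ t s₁Rt)
  ... | false = λ ()
  at-most-|S| : count (λ t → R M s₁ t ∧ inγ M α ŝ₂ t) ≤ count (inS M)
  at-most-|S| = count-mono target-in-S
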